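{- Let $\ell\ge1$, $V=\{0,1\}^{\ell^2}$, and let $\varphi$ be the modified CFLS coloring of the complete graph on $V$ defined in the context. There do not exist distinct $a,b,c,d,e\in V$ and colors $\alpha,\beta,\gamma$ with $\varphi(ab)=\varphi(cd)=\alpha$, $\varphi(ae)=\varphi(bc)=\beta$ and $\varphi(ac)=\varphi(de)=\gamma$.
   Context: Let $\ell$ be a positive integer and $V=\{0,1\}^{\ell^2}$. For $v\in V$ write $v=(v^{(1)},\dots,v^{(\ell)})$ with each block $v^{(k)}\in\{0,1\}^{\ell}$. For distinct $x,y\in V$ let $\varphi_1(x,y)=\big((i,\{x^{(i)},y^{(i)}\}),i_1,\dots,i_\ell\big)$, where $i$ is the least index with $x^{(i)}\ne y^{(i)}$, and $i_k=0$ if $x^{(k)}=y^{(k)}$, otherwise $i_k$ is the least position at which the bits of $x^{(k)}$ and $y^{(k)}$ differ. Order $V$ and $\{0,1\}^\ell$ by reading strings as binary integers (first bit most significant). For $x<y$ let $\varphi_2(x,y)=\varphi_2(y,x)=(\delta_1,\dots,\delta_\ell)$ with $\delta_k=-1$ if $x^{(k)}>y^{(k)}$ and $\delta_k=+1$ if $x^{(k)}\le y^{(k)}$. The modified CFLS coloring is $\varphi(xy)=(\varphi_1(x,y),\varphi_2(x,y))$. -}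

module Defs where

open import Data.Nat using (ℕ; zero; suc; _+_; _*_; _<ᵇ_)
open import Data.Bool using (Bool; true; false; if_then_else_)
open import Data.Fin using (Fin; zero; suc)
open import Data.Maybe using (Maybe; just; nothing)
open import Data.Product using (_×_; _,_)
open import Data.Vec using (Vec; []; _∷_; concat; zipWith)
open import Data.Vec.Properties using (≡-dec)
open import Data.Sign using (Sign)
open import Relation.Nullary using (yes; no)
import Data.Bool.Properties as BP

Bits : ℕ → Set
Bits n = Vec Bool n

-- V = {0,1}^(ℓ²), written as ℓ blocks of ℓ bits each: v = (v⁽¹⁾,…,v⁽ˡ⁾)
V : ℕ → Set
V ℓ = Vec (Bits ℓ) ℓ

-- value of a bit string read as a binary integer, first bit most significant
bin : ∀ {n} → Bits n → ℕ
bin = go 0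
  where
  go : ∀ {n} → ℕ → Bits n → ℕ
  go acc []          = acc
  go acc (b ∷ bs)    = go (2 * acc + (if b then 1 else 0)) bs

_<bits_ : ∀ {n} → Bits n → Bits n → Bool
u <bits w = bin u <ᵇ bin w

_<V_ : ∀ {ℓ} → V ℓ → V ℓ → Bool
x <V y = bin (concat x) <ᵇ bin (concat y)

_≟bits_ : ∀ {n} (u w : Bits n) → _
_≟bits_ = ≡-dec BP._≟_

firstDiffBit : ∀ {n} → Bits n → Bits n → Maybe (Fin n)
firstDiffBit []       []       = nothing
firstDiffBit (a ∷ as) (b ∷ bs) with a BP.≟ b
... | no _  = just zero
... | yes _ with firstDiffBit as bs
...   | nothing = nothing
...   | just i  = just (suc i)

firstDiffBlock : ∀ {m n} → Vec (Bits n) m → Vec (Bits n) m → Maybe (Fin m × Bits n × Bits n)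
firstDiffBlock []       []       = nothing
firstDiffBlock (a ∷ as) (b ∷ bs) with ≡-dec BP._≟_ a b
... | no _  = just (zero , a , b)
... | yes _ with firstDiffBlock as bs
...   | nothing          = nothing
...   | just (i , u , w) = just (suc i , u , w)

-- the unordered pair {u, w}, represented canonically as (min, max)
unordered : ∀ {n} → Bits n × Bits n → Bits n × Bits n
unordered (u , w) = if w <bits u then (w , u) else (u , w)

-- φ₁ colour type: (i, {x⁽ⁱ⁾, y⁽ⁱ⁾}) and (i₁,…,i_ℓ).
-- The index i is represented by Fin ℓ (0-based); each i_k is Maybe (Fin ℓ),
-- where nothing encodes "i_k = 0" (blocks equal) and just p the least differing position.
-- The first component is Maybe only so that φ₁ is total; for distinct x,y it is always just.
Col₁ : ℕ → Set
Col₁ ℓ = Maybe (Fin ℓ × (Bits ℓ × Bits ℓ)) × Vec (Maybe (Fin ℓ)) ℓ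

φ₁ : ∀ {ℓ} → V ℓ → V ℓ → Col₁ ℓ
φ₁ x y with firstDiffBlock x y
... | nothing          = nothing , zipWith firstDiffBit x y
... | just (i , u , w) = just (i , unordered (u , w)) , zipWith firstDiffBit x y

δ : ∀ {ℓ} → V ℓ → V ℓ → Vec Sign ℓ
δ x y = zipWith (λ u w → if w <bits u then Sign.- else Sign.+) x y

φ₂ : ∀ {ℓ} → V ℓ → V ℓ → Vec Sign ℓ
φ₂ x y = if x <V y then δ x y else δ y x

Colour : ℕ → Set
Colour ℓ = Col₁ ℓ × Vec Sign ℓ

φ : ∀ {ℓ} → V ℓ → V ℓ → Colour ℓ
φ x y = φ₁ x y , φ₂ x y

module Submission where

-- Since a ≠ c, the pair ac first differs in some block r, and φ(ac) = φ(de)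
-- forces de to first differ in the same block r with {a⁽ʳ⁾, c⁽ʳ⁾} = {d⁽ʳ⁾, e⁽ʳ⁾}.
-- Moreover φ(ab) = φ(cd) and φ(ae) = φ(bc) give, in block r, equalities between
-- the least differing positions (fd = firstDiffBit): fd(a,b) = fd(c,d) and
-- fd(a,e) = fd(b,c).  Writing a, …, e for the r-th blocks, two cases remain:
--   * d = a, e = c: then a, b, c pairwise first differ at the position p
--     where a and c first differ, so three bits at p are pairwise distinct — impossible;
--   * d = c, e = a: then fd(a,b) = fd(c,c) and fd(b,c) = fd(a,a) both say
--     "no difference", so a = b = c, contradicting the choice of r.

open import Defs
open import Data.Nat using (ℕ; _≤_)
open import Data.Bool using (Bool; true; false)
open import Data.Bool.Properties using () renaming (_≟_ to _≟B_)
open import Data.Empty using (⊥)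
open import Data.Fin using (Fin; zero; suc)
open import Data.Maybe using (just; nothing)
open import Data.Maybe.Properties using (just-injective)
open import Data.Product using (Σ; _×_; _,_; proj₁; proj₂)
open import Data.Product.Properties using (,-injectiveˡ; ,-injectiveʳ)
open import Data.Sum using (_⊎_; inj₁; inj₂)
open import Data.Vec using (Vec; []; _∷_; lookup; zipWith)
open import Data.Vec.Properties using (≡-dec; lookup-zipWith)
open import Relation.Binary.PropositionalEquality
  using (_≡_; _≢_; refl; sym; trans; cong; module ≡-Reasoning)
open import Relation.Nullary using (¬_; yes; no; contradiction)

firstDiffBit-self : ∀ {n} (u : Bits n) → firstDiffBit u u ≡ nothing
firstDiffBit-self []       = refl
firstDiffBit-self (x ∷ xs) with x ≟B x
... | no x≢x = contradiction refl x≢x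
... | yes _  rewrite firstDiffBit-self xs = refl

firstDiffBit-nothing : ∀ {n} (u w : Bits n) → firstDiffBit u w ≡ nothing → u ≡ w
firstDiffBit-nothing []       []       _  = refl
firstDiffBit-nothing (x ∷ xs) (y ∷ ys) eq with x ≟B y
firstDiffBit-nothing (x ∷ xs) (y ∷ ys) () | no _
... | yes refl with firstDiffBit xs ys in eqTail
...   | nothing rewrite firstDiffBit-nothing xs ys eqTail = refl
firstDiffBit-nothing (x ∷ xs) (y ∷ ys) () | yes refl | just _

firstDiffBit-comm : ∀ {n} (u w : Bits n) → firstDiffBit u w ≡ firstDiffBit w u
firstDiffBit-comm []       []       = refl
firstDiffBit-comm (x ∷ xs) (y ∷ ys) with x ≟B y | y ≟B x
... | no _    | no _    = refl
... | yes x≡y | no y≢x  = contradiction (sym x≡y) y≢x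
... | no x≢y  | yes y≡x = contradiction (sym y≡x) x≢y
... | yes _   | yes _   rewrite firstDiffBit-comm xs ys = refl

firstDiffBit-zero : ∀ {n} x y (xs ys : Bits n) →
  firstDiffBit (x ∷ xs) (y ∷ ys) ≡ just zero → x ≢ y
firstDiffBit-zero x y xs ys eq with x ≟B y
... | no x≢y = x≢y
... | yes _ with firstDiffBit xs ys
firstDiffBit-zero x y xs ys () | yes _ | nothing
firstDiffBit-zero x y xs ys () | yes _ | just _

firstDiffBit-suc : ∀ {n} x y (xs ys : Bits n) {i} →
  firstDiffBit (x ∷ xs) (y ∷ ys) ≡ just (suc i) → firstDiffBit xs ys ≡ just i
firstDiffBit-suc x y xs ys eq with x ≟B y
firstDiffBit-suc x y xs ys () | no _
... | yes _ with firstDiffBit xs ys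
firstDiffBit-suc x y xs ys ()   | yes _ | nothing
firstDiffBit-suc x y xs ys refl | yes _ | just _ = refl

no-three-distinct-bits : (x y z : Bool) → x ≢ y → y ≢ z → x ≢ z → ⊥
no-three-distinct-bits false false _     x≢y _   _   = x≢y refl
no-three-distinct-bits true  true  _     x≢y _   _   = x≢y refl
no-three-distinct-bits false true  false _   _   x≢z = x≢z refl
no-three-distinct-bits false true  true  _   y≢z _   = y≢z refl
no-three-distinct-bits true  false false _   y≢z _   = y≢z refl
no-three-distinct-bits true  false true  _   _   x≢z = x≢z refl

-- Three strings cannot pairwise first differ at one common position p:
-- the bits at p would be pairwise distinct.
no-common-first-difference : ∀ {n} (u v w : Bits n) (p : Fin n) →
  firstDiffBit u v ≡ just p → firstDiffBit v w ≡ just p → firstDiffBit u w ≡ just p → ⊥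
no-common-first-difference (x ∷ xs) (y ∷ ys) (z ∷ zs) zero uv vw uw =
  no-three-distinct-bits x y z
    (firstDiffBit-zero x y xs ys uv) (firstDiffBit-zero y z ys zs vw) (firstDiffBit-zero x z xs zs uw)
no-common-first-difference (x ∷ xs) (y ∷ ys) (z ∷ zs) (suc p) uv vw uw =
  no-common-first-difference xs ys zs p
    (firstDiffBit-suc x y xs ys uv) (firstDiffBit-suc y z ys zs vw) (firstDiffBit-suc x z xs zs uw)

unordered-≡ : ∀ {n} (u w u′ w′ : Bits n) → unordered (u , w) ≡ unordered (u′ , w′) →
  (u ≡ u′ × w ≡ w′) ⊎ (u ≡ w′ × w ≡ u′)
unordered-≡ u w u′ w′ eq with w <bits u | w′ <bits u′
unordered-≡ u w u′ w′ refl | false | false = inj₁ (refl , refl)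
unordered-≡ u w u′ w′ refl | false | true  = inj₂ (refl , refl)
unordered-≡ u w u′ w′ refl | true  | false = inj₂ (refl , refl)
unordered-≡ u w u′ w′ refl | true  | true  = inj₁ (refl , refl)

firstDiffBlock-nothing : ∀ {m n} (x y : Vec (Bits n) m) → firstDiffBlock x y ≡ nothing → x ≡ y
firstDiffBlock-nothing []       []       _  = refl
firstDiffBlock-nothing (x ∷ xs) (y ∷ ys) eq with ≡-dec _≟B_ x y
firstDiffBlock-nothing (x ∷ xs) (y ∷ ys) () | no _
... | yes refl with firstDiffBlock xs ys in eqTail
...   | nothing rewrite firstDiffBlock-nothing xs ys eqTail = refl
firstDiffBlock-nothing (x ∷ xs) (y ∷ ys) () | yes refl | just _

firstDiffBlock-just : ∀ {m n} (x y : Vec (Bits n) m) i u w →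
  firstDiffBlock x y ≡ just (i , u , w) → lookup x i ≡ u × lookup y i ≡ w × u ≢ w
firstDiffBlock-just (x ∷ xs) (y ∷ ys) i u w eq with ≡-dec _≟B_ x y
firstDiffBlock-just (x ∷ xs) (y ∷ ys) .zero .x .y refl | no x≢y = refl , refl , x≢y
... | yes _ with firstDiffBlock xs ys in eqTail
firstDiffBlock-just (x ∷ xs) (y ∷ ys) i u w () | yes _ | nothing
firstDiffBlock-just (x ∷ xs) (y ∷ ys) .(suc j) u w refl | yes _ | just (j , .u , .w) =
  firstDiffBlock-just xs ys j u w eqTail

φ₁-positions : ∀ {ℓ} (x y : V ℓ) → proj₂ (φ₁ x y) ≡ zipWith firstDiffBit x y
φ₁-positions x y with firstDiffBlock x y
... | nothing = refl
... | just _  = refl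

same-colour-positions : ∀ {ℓ} (x y x′ y′ : V ℓ) (r : Fin ℓ) → φ x y ≡ φ x′ y′ →
  firstDiffBit (lookup x r) (lookup y r) ≡ firstDiffBit (lookup x′ r) (lookup y′ r)
same-colour-positions x y x′ y′ r eq = begin
  firstDiffBit (lookup x r) (lookup y r)  ≡⟨ sym (lookup-zipWith firstDiffBit r x y) ⟩
  lookup (zipWith firstDiffBit x y) r     ≡⟨ cong (λ v → lookup v r) (sym (φ₁-positions x y)) ⟩
  lookup (proj₂ (φ₁ x y)) r               ≡⟨ cong (λ col → lookup (proj₂ (proj₁ col)) r) eq ⟩
  lookup (proj₂ (φ₁ x′ y′)) r             ≡⟨ cong (λ v → lookup v r) (φ₁-positions x′ y′) ⟩
  lookup (zipWith firstDiffBit x′ y′) r   ≡⟨ lookup-zipWith firstDiffBit r x′ y′ ⟩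
  firstDiffBit (lookup x′ r) (lookup y′ r) ∎
  where open ≡-Reasoning

same-colour-first-block : ∀ {ℓ} (x y x′ y′ : V ℓ) → x ≢ y → φ x y ≡ φ x′ y′ →
  Σ (Fin ℓ) λ r → lookup x r ≢ lookup y r
    × unordered (lookup x r , lookup y r) ≡ unordered (lookup x′ r , lookup y′ r)
same-colour-first-block x y x′ y′ x≢y eq
  with firstDiffBlock x y in eqXY | firstDiffBlock x′ y′ in eqXY′
... | nothing | _ = contradiction (firstDiffBlock-nothing x y eqXY) x≢y
same-colour-first-block x y x′ y′ x≢y () | just _ | nothing
... | just (r , u , w) | just (r′ , u′ , w′)
  with ,-injectiveˡ (just-injective (,-injectiveˡ (,-injectiveˡ eq)))
... | refl with firstDiffBlock-just x y r u w eqXY | firstDiffBlock-just x′ y′ r u′ w′ eqXY′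
...   | refl , refl , u≢w | refl , refl , _ =
  r , u≢w , ,-injectiveʳ (just-injective (,-injectiveˡ (,-injectiveˡ eq)))

-- Block-level contradiction, case {d,e} = {a,c} in order: a, b, c pairwise
-- first differ at the position where a and c first differ.
aligned-case-impossible : ∀ {n} (a b c : Bits n) → a ≢ c →
  firstDiffBit a b ≡ firstDiffBit c a → firstDiffBit a c ≡ firstDiffBit b c → ⊥
aligned-case-impossible a b c a≢c ab≡ca ac≡bc with firstDiffBit a c in ac
... | nothing = contradiction (firstDiffBit-nothing a c ac) a≢c
... | just p  = no-common-first-difference a b c p ab bc ac
  where
  ab : firstDiffBit a b ≡ just p
  ab = trans ab≡ca (trans (firstDiffBit-comm c a) ac)
  bc : firstDiffBit b c ≡ just p
  bc = sym ac≡bc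

-- Block-level contradiction, case {d,e} = {a,c} swapped: the equalities
-- force a = b and b = c.
swapped-case-impossible : ∀ {n} (a b c : Bits n) → a ≢ c →
  firstDiffBit a b ≡ firstDiffBit c c → firstDiffBit a a ≡ firstDiffBit b c → ⊥
swapped-case-impossible a b c a≢c ab≡cc aa≡bc = a≢c (trans a≡b b≡c)
  where
  a≡b : a ≡ b
  a≡b = firstDiffBit-nothing a b (trans ab≡cc (firstDiffBit-self c))
  b≡c : b ≡ c
  b≡c = firstDiffBit-nothing b c (trans (sym aa≡bc) (firstDiffBit-self a))

block-configuration-impossible : ∀ {n} (a b c d e : Bits n) → a ≢ c →
  unordered (a , c) ≡ unordered (d , e) →
  firstDiffBit a b ≡ firstDiffBit c d → firstDiffBit a e ≡ firstDiffBit b c → ⊥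
block-configuration-impossible a b c d e a≢c pairs ab≡cd ae≡bc with unordered-≡ a c d e pairs
... | inj₁ (refl , refl) = aligned-case-impossible a b c a≢c ab≡cd ae≡bc
... | inj₂ (refl , refl) = swapped-case-impossible a b c a≢c ab≡cd ae≡bc

lemma8 : (ℓ : ℕ) → 1 ≤ ℓ →
    ¬ (Σ (V ℓ) λ a → Σ (V ℓ) λ b → Σ (V ℓ) λ c → Σ (V ℓ) λ d → Σ (V ℓ) λ e →
       Σ (Colour ℓ) λ α → Σ (Colour ℓ) λ β → Σ (Colour ℓ) λ γ →
         (a ≢ b × a ≢ c × a ≢ d × a ≢ e × b ≢ c × b ≢ d × b ≢ e × c ≢ d × c ≢ e × d ≢ e)
       × (φ a b ≡ α × φ c d ≡ α)
       × (φ a e ≡ β × φ b c ≡ β)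
       × (φ a c ≡ γ × φ d e ≡ γ))
lemma8 ℓ _ (a , b , c , d , e , α , β , γ , (_ , a≢c , _) , (ab , cd) , (ae , bc) , (ac , de))
  with same-colour-first-block a c d e a≢c (trans ac (sym de))
... | r , aᵣ≢cᵣ , pairsᵣ =
  block-configuration-impossible (lookup a r) (lookup b r) (lookup c r) (lookup d r) (lookup e r)
    aᵣ≢cᵣ pairsᵣ
    (same-colour-positions a b c d r (trans ab (sym cd)))
    (same-colour-positions a e b c r (trans ae (sym bc)))
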